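{- Let $s\ge4$ and let $G$ be a finite simple undirected graph containing a copy $H$ of the $s$-gate as an induced subgraph, with $V(G)\setminus V(H)\neq\emptyset$, such that the edges of $G$ with exactly one endpoint in $V(H)$ are exactly $s$ external edges, one incident to each attachment vertex of $H$. Let $C$ be a Hamiltonian cycle of $G$ which visits all bottom-row vertices $b_1,b_2,\dots,b_{2s-7}$ of $H$ in succession (i.e. $b_1b_2\cdots b_{2s-7}$ is a subpath of $C$). Then $C$, upon entering $H$, visits all vertices of $H$ before exiting, i.e. $C$ contains exactly two external edges of $H$.
   Context: For an integer $s\ge4$, the $s$-gate is the simple undirected graph with vertex set $\{1,\dots,10\}\cup\{b_1,\dots,b_{2s-7}\}$ and edges $\{1,3\},\{1,8\},\{2,3\},\{2,5\},\{3,4\},\{4,5\},\{4,6\},\{6,7\},\{7,8\},\{7,10\},\{8,9\},\{9,10\}$, $\{5,b_1\}$, $\{10,b_{2s-7}\}$, $\{b_i,b_{i+1}\}$ ($1\le i\le 2s-8$) and $\{1,b_{2j}\}$ ($1\le j\le s-4$). Its attachment vertices are $1,2,9,b_1,b_3,\dots,b_{2s-7}$. The vertices $b_1,\dots,b_{2s-7}$ form the bottom row. -}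

module Defs where

open import Data.Nat using (ℕ; zero; suc; _+_; _*_; _∸_; _≤_)
import Data.Nat as ℕ
open import Data.Fin using (Fin; zero; suc; toℕ; fromℕ<)
open import Data.Product using (Σ; ∃; _×_; _,_)
open import Data.Sum using (_⊎_)
open import Relation.Nullary using (¬_; yes; no)
open import Relation.Binary.PropositionalEquality using (_≡_; _≢_)
open import Function.Definitions using (Injective; Surjective)

record SimpleGraph (n : ℕ) : Set₁ where
  field
    Adj     : Fin n → Fin n → Set
    symm    : ∀ {u v} → Adj u v → Adj v u
    irrefl  : ∀ {v} → ¬ Adj v v

-- The s-gate.  Inner vertices 1..10 are v1..v10.  The bottom row
-- b_1 .. b_{2s-7} is indexed by Fin (2s-7), with b_{k} ↦ index k-1
-- (0-based).

data Inner : Set where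
  v1 v2 v3 v4 v5 v6 v7 v8 v9 v10 : Inner

bottomSize : ℕ → ℕ
bottomSize s = 2 * s ∸ 7

data GateV (s : ℕ) : Set where
  inn : Inner → GateV s
  bot : Fin (bottomSize s) → GateV s

data GateEdge (s : ℕ) : GateV s → GateV s → Set where
  e1-3  : GateEdge s (inn v1) (inn v3)
  e1-8  : GateEdge s (inn v1) (inn v8)
  e2-3  : GateEdge s (inn v2) (inn v3)
  e2-5  : GateEdge s (inn v2) (inn v5)
  e3-4  : GateEdge s (inn v3) (inn v4)
  e4-5  : GateEdge s (inn v4) (inn v5)
  e4-6  : GateEdge s (inn v4) (inn v6)
  e6-7  : GateEdge s (inn v6) (inn v7)
  e7-8  : GateEdge s (inn v7) (inn v8)
  e7-10 : GateEdge s (inn v7) (inn v10)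
  e8-9  : GateEdge s (inn v8) (inn v9)
  e9-10 : GateEdge s (inn v9) (inn v10)
  e5-b  : (i : Fin (bottomSize s)) → toℕ i ≡ 0 → GateEdge s (inn v5) (bot i)
  e10-b : (i : Fin (bottomSize s)) → suc (toℕ i) ≡ bottomSize s → GateEdge s (inn v10) (bot i)
  eb-b  : (i j : Fin (bottomSize s)) → toℕ j ≡ suc (toℕ i) → GateEdge s (bot i) (bot j)
  -- {1, b_{2j}}, 1 ≤ j ≤ s-4 : 0-based indices 1,3,...,2s-9
  e1-b  : (i : Fin (bottomSize s)) (j : ℕ) → toℕ i ≡ suc (j + j) → GateEdge s (inn v1) (bot i)

GateAdj : (s : ℕ) → GateV s → GateV s → Set
GateAdj s u v = GateEdge s u v ⊎ GateEdge s v u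

-- attachment vertices 1, 2, 9, b_1, b_3, ..., b_{2s-7}
-- (0-based bottom indices 0,2,...,2s-8)
data Attachment (s : ℕ) : GateV s → Set where
  at1 : Attachment s (inn v1)
  at2 : Attachment s (inn v2)
  at9 : Attachment s (inn v9)
  atb : (i : Fin (bottomSize s)) (j : ℕ) → toℕ i ≡ j + j → Attachment s (bot i)

module _ {n : ℕ} (G : SimpleGraph n) (s : ℕ) (φ : GateV s → Fin n) where
  open SimpleGraph G

  InH : Fin n → Set
  InH v = ∃ λ u → φ u ≡ v

  IsInducedCopy : Set
  IsInducedCopy =
    Injective _≡_ _≡_ φ ×
    (∀ u v → (Adj (φ u) (φ v) → GateAdj s u v) × (GateAdj s u v → Adj (φ u) (φ v)))

  ExternalEdgesOK : Set
  ExternalEdgesOK = ∀ u →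
    (Attachment s u →
      ∃ λ w → ¬ InH w × Adj (φ u) w × (∀ w' → ¬ InH w' → Adj (φ u) w' → w' ≡ w)) ×
    (¬ Attachment s u → ∀ w → ¬ InH w → ¬ Adj (φ u) w)

next : ∀ {n} → Fin n → Fin n
next {suc n} i with suc (toℕ i) ℕ.<? suc n
... | yes p = fromℕ< p
... | no _  = zero

record HamCycle {n : ℕ} (G : SimpleGraph n) : Set where
  open SimpleGraph G
  field
    three≤n : 3 ≤ n
    c       : Fin n → Fin n
    c-inj   : Injective _≡_ _≡_ c
    c-surj  : Surjective _≡_ _≡_ c
    c-adj   : ∀ i → Adj (c i) (c (next i))

module _ {n : ℕ} {G : SimpleGraph n} (C : HamCycle G) where
  open HamCycle C

  CycleEdge : Fin n → Fin n → Set
  CycleEdge x y = ∃ λ i → (c i ≡ x × c (next i) ≡ y) ⊎ (c i ≡ y × c (next i) ≡ x)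

  CrossesAt : (Fin n → Set) → Fin n → Set
  CrossesAt P i = (P (c i) × ¬ P (c (next i))) ⊎ (¬ P (c i) × P (c (next i)))

module Submission where

-- Every vertex has exactly two neighbours on C.  Vertex 6 has degree two, so C contains 4–6–7.
-- Since C runs along the bottom row, its interior vertices b₂ … b_{2s-8} use no other edge; in
-- particular the edges from 1 to the row are not in C, and the row acts as one path from 5 to 10
-- whose two ends are the only places where it may leave H.  Branching on the successor of 4
-- (3 or 5), of 3 or 5, of 7 (8 or 10) and of 8 or 10, every branch either closes a cycle of C
-- inside H, impossible as H misses a vertex of G, or exhibits exactly two edges of C leaving H.

open import Data.Empty using (⊥; ⊥-elim)
open import Data.Unit using (⊤; tt)
open import Data.Fin using (Fin; zero; suc; toℕ; fromℕ; fromℕ<; inject₁; #_)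
open import Data.Fin.Properties using (toℕ-injective; toℕ-fromℕ<; toℕ<n; toℕ-fromℕ; toℕ-inject₁; fromℕ<-toℕ; _≟_; any?)
open import Data.Nat using (ℕ; zero; suc; _+_; _∸_; _≤_; _<_; s≤s; z≤n; _≤?_)
import Data.Nat as ℕ
open import Data.Nat.Properties
  using (suc-injective; ≤-antisym; ≮⇒≥; <-irrefl; 0≢1+n; m∸n+n≡m; ≤-pred; +-identityʳ; +-suc; ≤⇒≯; ≤-reflexive; ≤-trans; <⇒≢; m<n⇒m<1+n; n<1+n; <⇒≱; m≤n⇒m≤1+n; <⇒≤; m≤n⇒m<n∨m≡n; ≤-refl; ≤∧≢⇒<; ≤-<-connex)
open import Data.Product using (∃; ∃₂; _×_; _,_; proj₁; proj₂)
open import Data.Sum using (_⊎_; inj₁; inj₂; [_,_]′)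
open import Function using (_∘_; id; case_of_)
open import Relation.Nullary using (¬_; Dec; yes; no)
open import Relation.Nullary.Decidable using (map′; _⊎-dec_)
open import Data.Vec using ([]; _∷_; lookup)
open import Data.Nat.Tactic.RingSolver using (solve-∀)
open import Relation.Binary.PropositionalEquality
  using (_≡_; _≢_; refl; sym; trans; cong; subst; subst₂)

open import Defs

toℕ-next : ∀ {n} (i : Fin n) →
  (suc (toℕ i) < n × toℕ (next i) ≡ suc (toℕ i)) ⊎ (suc (toℕ i) ≡ n × toℕ (next i) ≡ 0)
toℕ-next {suc n} i with suc (toℕ i) ℕ.<? suc n
... | yes p = inj₁ (p , toℕ-fromℕ< p)
... | no ¬p = inj₂ (≤-antisym (toℕ<n i) (≮⇒≥ ¬p) , refl)

next-injective : ∀ {n} {i j : Fin n} → next i ≡ next j → i ≡ j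
next-injective {i = i} {j} e with toℕ-next i | toℕ-next j
... | inj₁ (_ , p) | inj₁ (_ , q) = toℕ-injective (suc-injective (trans (sym p) (trans (cong toℕ e) q)))
... | inj₁ (_ , p) | inj₂ (_ , q) = ⊥-elim (0≢1+n (trans (sym q) (trans (cong toℕ (sym e)) p)))
... | inj₂ (_ , p) | inj₁ (_ , q) = ⊥-elim (0≢1+n (trans (sym p) (trans (cong toℕ e) q)))
... | inj₂ (p , _) | inj₂ (q , _) = toℕ-injective (suc-injective (trans p (sym q)))

next-fromℕ : ∀ n → next (fromℕ n) ≡ zero
next-fromℕ n with toℕ-next (fromℕ n)
... | inj₁ (p , _) = ⊥-elim (<-irrefl (cong suc (toℕ-fromℕ n)) p)
... | inj₂ (_ , q) = toℕ-injective q

next-surjective : ∀ {n} (j : Fin n) → ∃ λ i → next i ≡ j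
next-surjective {suc n} zero = fromℕ n , next-fromℕ n
next-surjective {suc n} (suc j) with toℕ-next (inject₁ j)
... | inj₁ (_ , q) = inject₁ j , toℕ-injective (trans q (cong suc (toℕ-inject₁ j)))
... | inj₂ (p , _) = ⊥-elim (<-irrefl (sym (trans (sym p) (cong suc (toℕ-inject₁ j)))) (s≤s (toℕ<n j)))

next²≢id : ∀ {n} → 3 ≤ n → (i : Fin n) → next (next i) ≢ i
next²≢id {n} 3≤n i e = ≤⇒≯ n≤2 3≤n
  where
  n≤2 : n ≤ 2
  n≤2 with toℕ-next i | toℕ-next (next i)
  ... | inj₁ (_ , p) | inj₁ (_ , q) =
    ⊥-elim (<⇒≢ (m<n⇒m<1+n (n<1+n (toℕ i))) (trans (sym (cong toℕ e)) (trans q (cong suc p))))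
  ... | inj₁ (_ , p) | inj₂ (q , r) =
    ≤-reflexive (trans (sym q) (cong suc (trans p (cong suc (trans (sym (cong toℕ e)) r)))))
  ... | inj₂ (p , r) | inj₁ (_ , q) =
    ≤-reflexive (trans (sym p) (cong suc (trans (sym (cong toℕ e)) (trans q (cong suc r)))))
  ... | inj₂ (_ , r) | inj₂ (q , _) = ≤-trans (≤-reflexive (trans (sym q) (cong suc r))) (s≤s z≤n)

next-closed⇒universal : ∀ {n} (S : Fin n → Set) → (∀ i → S i → S (next i)) → ∀ {i} → S i → ∀ j → S j
next-closed⇒universal {suc m} S step {i} si j = climb (toℕ j) (sym (+-identityʳ (toℕ j))) S-zero
  where
  climb : ∀ d {i j} → toℕ j ≡ d + toℕ i → S i → S j
  climb zero e si = subst S (toℕ-injective (sym e)) si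
  climb (suc d) {j = j} e si with next-surjective j
  ... | p , refl with toℕ-next p
  ...   | inj₁ (_ , q) = step p (climb d (suc-injective (trans (sym q) e)) si)
  ...   | inj₂ (_ , q) = ⊥-elim (0≢1+n (trans (sym q) e))

  S-zero : S zero
  S-zero = subst S (next-fromℕ m)
    (step _ (climb (m ∸ toℕ i) (trans (toℕ-fromℕ m) (sym (m∸n+n≡m (≤-pred (toℕ<n i))))) si))

module HamiltonianCycle {n : ℕ} {G : SimpleGraph n} (C : HamCycle G) where
  open SimpleGraph G
  open HamCycle C

  infix 4 _~_
  _~_ : Fin n → Fin n → Set
  _~_ = CycleEdge C

  EdgeAt : Fin n → Fin n → Fin n → Set
  EdgeAt x y i = (c i ≡ x × c (next i) ≡ y) ⊎ (c i ≡ y × c (next i) ≡ x)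

  ~-sym : ∀ {x y} → x ~ y → y ~ x
  ~-sym (i , inj₁ e) = i , inj₂ e
  ~-sym (i , inj₂ e) = i , inj₁ e

  ~⇒Adj : ∀ {x y} → x ~ y → Adj x y
  ~⇒Adj (i , inj₁ (refl , refl)) = c-adj i
  ~⇒Adj (i , inj₂ (refl , refl)) = symm (c-adj i)

  position : ∀ x → ∃ λ i → c i ≡ x
  position x = proj₁ (c-surj x) , proj₂ (c-surj x) refl

  neighbour-positions : ∀ {p w} → c p ~ w → w ≡ c (next p) ⊎ ∃ λ i → next i ≡ p × w ≡ c i
  neighbour-positions (i , inj₁ (e , refl)) = inj₁ (cong (λ j → c (next j)) (c-inj e))
  neighbour-positions (i , inj₂ (refl , e)) = inj₂ (i , c-inj e , refl)

  two-neighbours : ∀ x → ∃₂ λ y z → y ≢ z × x ~ y × x ~ z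
  two-neighbours x with position x
  ... | p , refl with next-surjective p
  ...   | q , refl =
    c (next (next q)) , c q , (λ e → next²≢id three≤n q (c-inj e)) ,
    (next q , inj₁ (refl , refl)) , (q , inj₂ (refl , refl))

  at-most-two : ∀ {x y z w} → x ~ y → x ~ z → y ≢ z → x ~ w → w ≡ y ⊎ w ≡ z
  at-most-two {x} x~y x~z y≢z x~w with position x
  ... | p , refl with neighbour-positions x~y | neighbour-positions x~z | neighbour-positions x~w
  ... | inj₁ a | inj₁ b | _ = ⊥-elim (y≢z (trans a (sym b)))
  ... | inj₁ a | inj₂ _ | inj₁ e = inj₁ (trans e (sym a))
  ... | inj₂ _ | inj₁ b | inj₁ e = inj₂ (trans e (sym b))
  ... | inj₁ _ | inj₂ (i , ei , b) | inj₂ (j , ej , e) =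
    inj₂ (trans e (trans (cong c (next-injective (trans ej (sym ei)))) (sym b)))
  ... | inj₂ (i , ei , a) | inj₁ _ | inj₂ (j , ej , e) =
    inj₁ (trans e (trans (cong c (next-injective (trans ej (sym ei)))) (sym a)))
  ... | inj₂ (i , ei , a) | inj₂ (j , ej , b) | _ =
    ⊥-elim (y≢z (trans a (trans (cong c (next-injective (trans ei (sym ej)))) (sym b))))

  EdgeAt-unique : ∀ {x y i j} → EdgeAt x y i → EdgeAt x y j → i ≡ j
  EdgeAt-unique (inj₁ (a , _)) (inj₁ (b , _)) = c-inj (trans a (sym b))
  EdgeAt-unique (inj₂ (a , _)) (inj₂ (b , _)) = c-inj (trans a (sym b))
  EdgeAt-unique {i = i} (inj₁ (a , b)) (inj₂ (a' , b')) =
    ⊥-elim (next²≢id three≤n i (trans (cong next (c-inj (trans b (sym a')))) (c-inj (trans b' (sym a)))))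
  EdgeAt-unique {i = i} (inj₂ (a , b)) (inj₁ (a' , b')) =
    ⊥-elim (next²≢id three≤n i (trans (cong next (c-inj (trans b (sym a')))) (c-inj (trans b' (sym a)))))

  closed⇒universal : (S : Fin n → Set) → (∀ {x y} → S x → x ~ y → S y) → ∀ {x} → S x → ∀ y → S y
  closed⇒universal S closed {x} Sx y with position x | position y
  ... | p , refl | q , refl =
    next-closed⇒universal (λ i → S (c i)) (λ i Sci → closed Sci (i , inj₁ (refl , refl))) Sx q

  Crossing : (Fin n → Set) → Fin n → Fin n → Set
  Crossing P x y = P x × ¬ P y × x ~ y

  ExactlyTwoCrossings : (Fin n → Set) → Set
  ExactlyTwoCrossings P = ∃ λ i → ∃ λ j → i ≢ j × CrossesAt C P i × CrossesAt C P j ×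
    (∀ k → CrossesAt C P k → k ≡ i ⊎ k ≡ j)

  exactly-two-crossings : (P : Fin n → Set) {x₁ y₁ x₂ y₂ : Fin n} →
    Crossing P x₁ y₁ → Crossing P x₂ y₂ → x₁ ≢ x₂ →
    (∀ {x y} → Crossing P x y → (x , y) ≡ (x₁ , y₁) ⊎ (x , y) ≡ (x₂ , y₂)) →
    ExactlyTwoCrossings P
  exactly-two-crossings P {x₁} {y₁} {x₂} {y₂} (Px₁ , ¬Py₁ , i , eᵢ) (Px₂ , ¬Py₂ , j , eⱼ) x₁≢x₂ only =
    i , j , i≢j , crosses-at eᵢ Px₁ ¬Py₁ , crosses-at eⱼ Px₂ ¬Py₂ , crossing-index
    where
    crosses-at : ∀ {x y k} → EdgeAt x y k → P x → ¬ P y → CrossesAt C P k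
    crosses-at (inj₁ (refl , refl)) Px ¬Py = inj₁ (Px , ¬Py)
    crosses-at (inj₂ (refl , refl)) Px ¬Py = inj₂ (¬Py , Px)

    not-shared : ∀ {k} → EdgeAt x₁ y₁ k → EdgeAt x₂ y₂ k → ⊥
    not-shared (inj₁ (a , _)) (inj₁ (b , _)) = x₁≢x₂ (trans (sym a) b)
    not-shared (inj₂ (_ , a)) (inj₂ (_ , b)) = x₁≢x₂ (trans (sym a) b)
    not-shared (inj₁ (a , _)) (inj₂ (b , _)) = ¬Py₂ (subst P (trans (sym a) b) Px₁)
    not-shared (inj₂ (a , _)) (inj₁ (b , _)) = ¬Py₁ (subst P (trans (sym b) a) Px₂)

    i≢j : i ≢ j
    i≢j refl = not-shared eᵢ eⱼ

    index-of : ∀ {k x y} → EdgeAt x y k → (x , y) ≡ (x₁ , y₁) ⊎ (x , y) ≡ (x₂ , y₂) → k ≡ i ⊎ k ≡ j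
    index-of e (inj₁ refl) = inj₁ (EdgeAt-unique e eᵢ)
    index-of e (inj₂ refl) = inj₂ (EdgeAt-unique e eⱼ)

    crossing-index : ∀ k → CrossesAt C P k → k ≡ i ⊎ k ≡ j
    crossing-index k (inj₁ (Pc , ¬Pc')) = index-of (inj₁ (refl , refl)) (only (Pc , ¬Pc' , k , inj₁ (refl , refl)))
    crossing-index k (inj₂ (¬Pc , Pc')) = index-of (inj₂ (refl , refl)) (only (Pc' , ¬Pc , k , inj₂ (refl , refl)))

  neighbours-within : (S : Fin n → Set) → ∀ {x p q} → S p → S q → x ~ p → x ~ q → p ≢ q →
    ∀ {y} → x ~ y → S y
  neighbours-within S Sp Sq x~p x~q p≢q x~y with at-most-two x~p x~q p≢q x~y
  ... | inj₁ refl = Sp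
  ... | inj₂ refl = Sq

  neighbour-other-than : ∀ x p → ∃ λ w → w ≢ p × x ~ w
  neighbour-other-than x p with two-neighbours x
  ... | y , z , y≢z , x~y , x~z with y ≟ p
  ...   | yes refl = z , y≢z ∘ sym , x~z
  ...   | no y≢p = y , y≢p , x~y

  both-of-two : ∀ {x p q} → p ≢ q → (∀ {y} → x ~ y → y ≡ p ⊎ y ≡ q) → x ~ p × x ~ q
  both-of-two {x} p≢q within with two-neighbours x
  ... | y , z , y≢z , x~y , x~z with within x~y | within x~z
  ... | inj₁ refl | inj₂ refl = x~y , x~z
  ... | inj₂ refl | inj₁ refl = x~z , x~y
  ... | inj₁ refl | inj₁ refl = ⊥-elim (y≢z refl)
  ... | inj₂ refl | inj₂ refl = ⊥-elim (y≢z refl)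

  record ThreeNeighbours (x p q r : Fin n) : Set where
    field
      within : ∀ {y} → x ~ y → y ≡ p ⊎ y ≡ q ⊎ y ≡ r
      p≢q : p ≢ q
      p≢r : p ≢ r
      q≢r : q ≢ r

  module _ {x p q r : Fin n} (N : ThreeNeighbours x p q r) where
    open ThreeNeighbours N

    swap-first : ThreeNeighbours x q p r
    swap-first = record
      { within = λ x~y → [ inj₂ ∘ inj₁ , [ inj₁ , inj₂ ∘ inj₂ ]′ ]′ (within x~y)
      ; p≢q = p≢q ∘ sym ; p≢r = q≢r ; q≢r = p≢r }

    not-third : x ~ p → x ~ q → ¬ x ~ r
    not-third x~p x~q x~r = [ p≢r ∘ sym , q≢r ∘ sym ]′ (at-most-two x~p x~q p≢q x~r)

    others-if-not-first : ¬ x ~ p → x ~ q × x ~ r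
    others-if-not-first x≁p = both-of-two q≢r λ x~y → [ (λ { refl → ⊥-elim (x≁p x~y) }) , id ]′ (within x~y)

    one-other-if-first : x ~ p → (x ~ q × ¬ x ~ r) ⊎ (x ~ r × ¬ x ~ q)
    one-other-if-first x~p with neighbour-other-than x p
    ... | w , w≢p , x~w with within x~w
    ... | inj₁ w≡p = ⊥-elim (w≢p w≡p)
    ... | inj₂ (inj₁ refl) = inj₁ (x~w , not-third x~p x~w)
    ... | inj₂ (inj₂ refl) = inj₂ (x~w , λ x~q → [ p≢q ∘ sym , q≢r ]′ (at-most-two x~p x~w p≢r x~q))

Even Odd : ℕ → Set
Even k = ∃ λ j → k ≡ j + j
Odd k = ∃ λ j → k ≡ suc (j + j)

odd⇒¬even : ∀ {k} → Odd k → ¬ Even k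
odd⇒¬even (j , refl) (i , e) = odd≢even j i e
  where
  odd≢even : ∀ j i → suc (j + j) ≢ i + i
  odd≢even _       zero    ()
  odd≢even zero    (suc i) e = 0≢1+n (trans (suc-injective e) (+-suc i i))
  odd≢even (suc j) (suc i) e =
    odd≢even j i (suc-injective (trans (sym (cong suc (+-suc j j))) (trans (suc-injective e) (+-suc i i))))

bottomSize≡ : ∀ {s} → 4 ≤ s → bottomSize s ≡ suc ((s ∸ 4) + (s ∸ 4))
bottomSize≡ {suc (suc (suc (suc r)))} (s≤s (s≤s (s≤s (s≤s _)))) = cong (_∸ 3) (twice r)
  where
  -- the shape to which 2 * (4 + r) ∸ 7 reduces
  twice : ∀ r → r + (4 + (r + 0)) ≡ 3 + suc (r + r)
  twice = solve-∀

inner : Fin 10 → Inner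
inner = lookup (v1 ∷ v2 ∷ v3 ∷ v4 ∷ v5 ∷ v6 ∷ v7 ∷ v8 ∷ v9 ∷ v10 ∷ [])

inner-surjective : ∀ v → ∃ λ k → inner k ≡ v
inner-surjective v1  = # 0 , refl
inner-surjective v2  = # 1 , refl
inner-surjective v3  = # 2 , refl
inner-surjective v4  = # 3 , refl
inner-surjective v5  = # 4 , refl
inner-surjective v6  = # 5 , refl
inner-surjective v7  = # 6 , refl
inner-surjective v8  = # 7 , refl
inner-surjective v9  = # 8 , refl
inner-surjective v10 = # 9 , refl

gate-any? : ∀ {s} {P : GateV s → Set} → (∀ u → Dec (P u)) → Dec (∃ P)
gate-any? {P = P} P? = map′ to from (any? (P? ∘ inn ∘ inner) ⊎-dec any? (P? ∘ bot))
  where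
  to : (∃ λ k → P (inn (inner k))) ⊎ (∃ λ i → P (bot i)) → ∃ P
  to (inj₁ (k , p)) = inn (inner k) , p
  to (inj₂ (i , p)) = bot i , p
  from : ∃ P → (∃ λ k → P (inn (inner k))) ⊎ (∃ λ i → P (bot i))
  from (inn v , p) with inner-surjective v
  ... | k , refl = inj₁ (k , p)
  from (bot i , p) = inj₂ (i , p)

module GateInCycle
  (s : ℕ) (4≤s : 4 ≤ s) {n : ℕ} (G : SimpleGraph n) (φ : GateV s → Fin n)
  (induced : IsInducedCopy G s φ) (outside : ∃ λ v → ¬ InH G s φ v)
  (external : ExternalEdgesOK G s φ) (C : HamCycle G)
  (bottom-path : ∀ (i j : Fin (bottomSize s)) → toℕ j ≡ suc (toℕ i) → CycleEdge C (φ (bot i)) (φ (bot j)))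
  where

  open SimpleGraph G
  open HamiltonianCycle C

  H : Fin n → Set
  H = InH G s φ

  φ-injective : ∀ {a b} → φ a ≡ φ b → a ≡ b
  φ-injective = proj₁ induced

  φ-≢ : ∀ {a b} → a ≢ b → φ a ≢ φ b
  φ-≢ a≢b = a≢b ∘ φ-injective

  inn-injective : ∀ {v w} → inn {s} v ≡ inn w → v ≡ w
  inn-injective refl = refl

  inside≢outside : ∀ {x y} → H x → ¬ H y → x ≢ y
  inside≢outside Hx ¬Hy refl = ¬Hy Hx

  g : Inner → Fin n
  g v = φ (inn v)

  H? : ∀ y → Dec (H y)
  H? y = gate-any? (λ u → φ u ≟ y)

  ext : ∀ u → Attachment s u → Fin n
  ext u at = proj₁ (proj₁ (external u) at)

  ext-outside : ∀ u at → ¬ H (ext u at)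
  ext-outside u at = proj₁ (proj₂ (proj₁ (external u) at))

  ext-unique : ∀ u at {y} → ¬ H y → φ u ~ y → y ≡ ext u at
  ext-unique u at ¬Hy e = proj₂ (proj₂ (proj₂ (proj₁ (external u) at))) _ ¬Hy (~⇒Adj e)

  no-exit : ∀ {u y} → ¬ Attachment s u → ¬ H y → ¬ φ u ~ y
  no-exit {u} ¬at ¬Hy e = proj₂ (external u) ¬at _ ¬Hy (~⇒Adj e)

  neighbour-cases : ∀ u {y} → φ u ~ y →
    (∃ λ a → GateAdj s u a × y ≡ φ a) ⊎ ¬ H y
  neighbour-cases u {y} e with H? y
  ... | yes (a , refl) = inj₁ (a , proj₁ (proj₂ induced u a) (~⇒Adj e) , refl)
  ... | no ¬Hy = inj₂ ¬Hy

  closed-neighbour : ∀ {u y} → ¬ Attachment s u → φ u ~ y → ∃ λ a → GateAdj s u a × y ≡ φ a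
  closed-neighbour {u} ¬at e with neighbour-cases u e
  ... | inj₁ inside = inside
  ... | inj₂ ¬Hy = ⊥-elim (no-exit ¬at ¬Hy e)

  attachment-neighbour : ∀ {u y} (at : Attachment s u) → φ u ~ y →
    (∃ λ a → GateAdj s u a × y ≡ φ a) ⊎ y ≡ ext u at
  attachment-neighbour {u} at e with neighbour-cases u e
  ... | inj₁ inside = inj₁ inside
  ... | inj₂ ¬Hy = inj₂ (ext-unique u at ¬Hy e)

  N L : ℕ
  N = bottomSize s
  L = (s ∸ 4) + (s ∸ 4)

  N≡1+L : N ≡ suc L
  N≡1+L = bottomSize≡ 4≤s

  index≤L : (i : Fin N) → toℕ i ≤ L
  index≤L i = ≤-pred (subst (toℕ i <_) N≡1+L (toℕ<n i))

  bottom-index : ∀ {k} → k ≤ L → ∃ λ (i : Fin N) → toℕ i ≡ k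
  bottom-index {k} k≤L = fromℕ< (subst (k <_) (sym N≡1+L) (s≤s k≤L)) , toℕ-fromℕ< _

  -- row k is the k-th vertex of the path 5, b₁, …, b_{2s-7}, 10, so b_k = row k and 10 = row (2 + L);
  -- beyond the path it stays at 10.
  row : ℕ → GateV s
  row zero = inn v5
  row (suc k) with k ≤? L
  ... | yes k≤L = bot (proj₁ (bottom-index k≤L))
  ... | no _    = inn v10

  r : ℕ → Fin n
  r k = φ (row k)

  row-bot : ∀ {k} (i : Fin N) → toℕ i ≡ k → row (suc k) ≡ bot i
  row-bot i refl with toℕ i ≤? L
  ... | yes _    = cong bot (fromℕ<-toℕ i _)
  ... | no i≰L   = ⊥-elim (i≰L (index≤L i))

  row-beyond : ∀ {k} → L < k → row (suc k) ≡ inn v10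
  row-beyond {k} L<k with k ≤? L
  ... | yes k≤L = ⊥-elim (<⇒≱ L<k k≤L)
  ... | no _    = refl

  row-last : g v10 ≡ r (suc (suc L))
  row-last = cong φ (sym (row-beyond (n<1+n L)))

  row≢inn : ∀ k {v} → v ≢ v5 → v ≢ v10 → row k ≢ inn v
  row≢inn zero v≢5 _ refl = v≢5 refl
  row≢inn (suc k) v≢5 v≢10 e with k ≤? L
  row≢inn (suc k) v≢5 v≢10 () | yes _
  row≢inn (suc k) v≢5 v≢10 refl | no _ = v≢10 refl

  -- The position of a vertex along the row; the value on 1, 2, 3, 4, 6, 7, 8, 9 is arbitrary.
  row-position : GateV s → ℕ
  row-position (inn v5)  = zero
  row-position (bot i)   = suc (toℕ i)
  row-position (inn _)   = suc (suc L)

  row-position-row : ∀ {k} → k ≤ suc (suc L) → row-position (row k) ≡ k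
  row-position-row {zero} _ = refl
  row-position-row {suc k} k≤ with k ≤? L
  ... | yes _   = cong suc (toℕ-fromℕ< _)
  ... | no k≰L  = cong suc (≤-antisym (≮⇒≥ (k≰L ∘ ≤-pred)) (≤-pred k≤))

  row-injective : ∀ {j k} → j ≤ suc (suc L) → k ≤ suc (suc L) → r j ≡ r k → j ≡ k
  row-injective j≤ k≤ e =
    trans (sym (row-position-row j≤)) (trans (cong row-position (φ-injective e)) (row-position-row k≤))

  r≢r₊₂ : ∀ {k} → k ≤ L → r k ≢ r (suc (suc k))
  r≢r₊₂ {k} k≤L e = <⇒≢ (m<n⇒m<1+n (n<1+n k))
    (row-injective (m≤n⇒m≤1+n (m≤n⇒m≤1+n k≤L)) (s≤s (s≤s k≤L)) e)

  RowEdge : ℕ → Set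
  RowEdge k = r k ~ r (suc k)

  row-edge : ∀ {k} → k < L → RowEdge (suc k)
  row-edge k<L with bottom-index (<⇒≤ k<L) | bottom-index k<L
  ... | i , refl | j , j≡ =
    subst₂ _~_ (cong φ (sym (row-bot i refl))) (cong φ (sym (row-bot j j≡))) (bottom-path i j j≡)

  edge-into : g v5 ~ r 1 → ∀ {k} → k ≤ L → RowEdge k
  edge-into 5~b₁ {zero}  _     = 5~b₁
  edge-into 5~b₁ {suc k} 1+k≤L = row-edge 1+k≤L

  edge-out-of : g v10 ~ r (suc L) → ∀ {k} → k ≤ L → RowEdge (suc k)
  edge-out-of 10~bₗ k≤L with m≤n⇒m<n∨m≡n k≤L
  ... | inj₁ k<L = row-edge k<L
  ... | inj₂ refl = subst (r (suc L) ~_) row-last (~-sym 10~bₗ)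

  OnRow : Fin n → Set
  OnRow y = ∃ λ k → y ≡ r k

  on-row-inside : ∀ {y} → OnRow y → H y
  on-row-inside (k , refl) = row k , refl

  row-closed : ∀ {k y} → k ≤ L → RowEdge k → RowEdge (suc k) → r (suc k) ~ y → OnRow y
  row-closed {k} k≤L e e′ e″ with at-most-two (~-sym e) e′ (r≢r₊₂ k≤L) e″
  ... | inj₁ y≡ = k , y≡
  ... | inj₂ y≡ = suc (suc k) , y≡

  bot-adj : ∀ (i : Fin N) {a} → GateAdj s (bot i) a →
    a ≡ row (toℕ i) ⊎ a ≡ row (suc (suc (toℕ i))) ⊎ (a ≡ inn v1 × Odd (toℕ i))
  bot-adj i (inj₁ (eb-b _ j p))  = inj₂ (inj₁ (sym (row-bot j p)))
  bot-adj i (inj₂ (eb-b j _ p))  = inj₁ (sym (trans (cong row p) (row-bot j refl)))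
  bot-adj i (inj₂ (e5-b _ p))    = inj₁ (sym (cong row p))
  bot-adj i (inj₂ (e10-b _ p))   =
    inj₂ (inj₁ (sym (row-beyond (≤-reflexive (sym (trans p N≡1+L))))))
  bot-adj i (inj₂ (e1-b _ j p))  = inj₂ (inj₂ (refl , j , p))

  row-attachment : ∀ {k} → k ≤ L → Even k → Attachment s (row (suc k))
  row-attachment k≤L (j , k≡) with bottom-index k≤L
  ... | i , refl = subst (Attachment s) (sym (row-bot i refl)) (atb i j k≡)

  row-neighbours-at-attachment : ∀ {k y} (k≤L : k ≤ L) (even : Even k) → r (suc k) ~ y →
    y ≡ r k ⊎ y ≡ r (suc (suc k)) ⊎ y ≡ ext (row (suc k)) (row-attachment k≤L even)
  row-neighbours-at-attachment {k} k≤L even e with attachment-neighbour (row-attachment k≤L even) e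
  ... | inj₂ y≡ext = inj₂ (inj₂ y≡ext)
  ... | inj₁ (a , adj , refl) with bottom-index k≤L
  ...   | i , refl with bot-adj i (subst (λ u → GateAdj s u a) (row-bot i refl) adj)
  ...     | inj₁ refl = inj₁ refl
  ...     | inj₂ (inj₁ refl) = inj₂ (inj₁ refl)
  ...     | inj₂ (inj₂ (_ , odd)) = ⊥-elim (odd⇒¬even odd even)

  no-row-exit : g v5 ~ r 1 → g v10 ~ r (suc L) → ∀ {k y} → k ≤ L → ¬ H y → ¬ r (suc k) ~ y
  no-row-exit 5~b₁ 10~bₗ k≤L ¬Hy e =
    ¬Hy (on-row-inside (row-closed k≤L (edge-into 5~b₁ k≤L) (edge-out-of 10~bₗ k≤L) e))

  UniqueRowExit : ℕ → Fin n → Set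
  UniqueRowExit k y = k ≤ L × ¬ H y × r (suc k) ~ y ×
    (∀ {k′ y′} → k′ ≤ L → ¬ H y′ → r (suc k′) ~ y′ → (r (suc k′) , y′) ≡ (r (suc k) , y))

  row-end-exit : g v5 ~ r 1 → ¬ g v10 ~ r (suc L) → ∃ (UniqueRowExit L)
  row-end-exit 5~b₁ 10≁bₗ = ext _ at , ≤-refl , ext-outside _ at , exit , only
    where
    even : Even L
    even = s ∸ 4 , refl
    at = row-attachment ≤-refl even

    exit : r (suc L) ~ ext _ at
    exit with neighbour-other-than (r (suc L)) (r L)
    ... | w , w≢bₗ₋₁ , e with row-neighbours-at-attachment ≤-refl even e
    ...   | inj₁ refl = ⊥-elim (w≢bₗ₋₁ refl)
    ...   | inj₂ (inj₁ refl) = ⊥-elim (10≁bₗ (subst (_~ r (suc L)) (sym row-last) (~-sym e)))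
    ...   | inj₂ (inj₂ refl) = e

    only : ∀ {k y} → k ≤ L → ¬ H y → r (suc k) ~ y → (r (suc k) , y) ≡ (r (suc L) , ext _ at)
    only k≤L ¬Hy e with m≤n⇒m<n∨m≡n k≤L
    ... | inj₁ k<L = ⊥-elim (¬Hy (on-row-inside (row-closed k≤L (edge-into 5~b₁ k≤L) (row-edge k<L) e)))
    ... | inj₂ refl with row-neighbours-at-attachment ≤-refl even e
    ...   | inj₁ y≡ = ⊥-elim (¬Hy (on-row-inside (L , y≡)))
    ...   | inj₂ (inj₁ y≡) = ⊥-elim (¬Hy (on-row-inside (suc (suc L) , y≡)))
    ...   | inj₂ (inj₂ refl) = refl

  row-start-exit : ¬ g v5 ~ r 1 → g v10 ~ r (suc L) → ∃ (UniqueRowExit 0)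
  row-start-exit 5≁b₁ 10~bₗ = ext _ at , z≤n , ext-outside _ at , exit , only
    where
    even : Even 0
    even = 0 , refl
    at = row-attachment z≤n even

    exit : r 1 ~ ext _ at
    exit with neighbour-other-than (r 1) (r 2)
    ... | w , w≢b₂ , e with row-neighbours-at-attachment z≤n even e
    ...   | inj₁ refl = ⊥-elim (5≁b₁ (~-sym e))
    ...   | inj₂ (inj₁ refl) = ⊥-elim (w≢b₂ refl)
    ...   | inj₂ (inj₂ refl) = e

    only : ∀ {k y} → k ≤ L → ¬ H y → r (suc k) ~ y → (r (suc k) , y) ≡ (r 1 , ext _ at)
    only {suc k} k<L ¬Hy e = ⊥-elim (¬Hy (on-row-inside (row-closed k<L (row-edge k<L) (edge-out-of 10~bₗ k<L) e)))
    only {zero} _ ¬Hy e with row-neighbours-at-attachment z≤n even e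
    ... | inj₁ y≡ = ⊥-elim (¬Hy (on-row-inside (0 , y≡)))
    ... | inj₂ (inj₁ y≡) = ⊥-elim (¬Hy (on-row-inside (2 , y≡)))
    ... | inj₂ (inj₂ refl) = refl

  not-on-row : ∀ {v} → v ≢ v5 → v ≢ v10 → ¬ OnRow (g v)
  not-on-row v≢5 v≢10 (k , e) = row≢inn k v≢5 v≢10 (sym (φ-injective e))

  g≢r : ∀ {v} k → v ≢ v5 → v ≢ v10 → g v ≢ r k
  g≢r k v≢5 v≢10 e = not-on-row v≢5 v≢10 (k , e)

  interior-row-closed : ∀ {k y} → 0 < k → k < L → r (suc k) ~ y → OnRow y
  interior-row-closed {suc k} _ 1+k<L = row-closed (<⇒≤ 1+k<L) (row-edge (<⇒≤ 1+k<L)) (row-edge 1+k<L)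

  -- The even vertices b₂, b₄, … adjacent to 1 are interior to the bottom row, so C passes them along the row.
  not-1~odd-bot : ∀ (i : Fin N) → Odd (toℕ i) → ¬ g v1 ~ φ (bot i)
  not-1~odd-bot i (j , p) e = not-on-row (λ ()) (λ ()) (interior-row-closed 0<i i<L (subst (_~ g v1) b≡ (~-sym e)))
    where
    0<i : 0 < toℕ i
    0<i = subst (0 <_) (sym p) (s≤s z≤n)
    i<L : toℕ i < L
    i<L = ≤∧≢⇒< (index≤L i) (λ i≡L → odd⇒¬even (j , p) (s ∸ 4 , i≡L))
    b≡ : φ (bot i) ≡ r (suc (toℕ i))
    b≡ = cong φ (sym (row-bot i refl))

  data Port : Set where
    port₁ port₂ port₉ : Port

  portVertex : Port → Inner
  portVertex port₁ = v1
  portVertex port₂ = v2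
  portVertex port₉ = v9

  port-attachment : ∀ p → Attachment s (inn (portVertex p))
  port-attachment port₁ = at1
  port-attachment port₂ = at2
  port-attachment port₉ = at9

  portExt : Port → Fin n
  portExt p = ext (inn (portVertex p)) (port-attachment p)

  port≢5 : ∀ p → portVertex p ≢ v5
  port≢5 port₁ ()
  port≢5 port₂ ()
  port≢5 port₉ ()

  port≢10 : ∀ p → portVertex p ≢ v10
  port≢10 port₁ ()
  port≢10 port₂ ()
  port≢10 port₉ ()

  Exit : Port → Set
  Exit p = g (portVertex p) ~ portExt p

  g≢ext : ∀ {v} p → g v ≢ portExt p
  g≢ext p = inside≢outside (inn _ , refl) (ext-outside _ (port-attachment p))

  6-neighbours : g v6 ~ g v4 × g v6 ~ g v7
  6-neighbours = both-of-two (φ-≢ (λ ())) λ e → case closed-neighbour (λ ()) e of λ where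
    (_ , inj₁ e6-7 , refl) → inj₂ refl
    (_ , inj₂ e4-6 , refl) → inj₁ refl

  4-neighbours : ThreeNeighbours (g v4) (g v6) (g v3) (g v5)
  4-neighbours = record
    { within = λ e → case closed-neighbour (λ ()) e of λ where
        (_ , inj₁ e4-5 , refl) → inj₂ (inj₂ refl)
        (_ , inj₁ e4-6 , refl) → inj₁ refl
        (_ , inj₂ e3-4 , refl) → inj₂ (inj₁ refl)
    ; p≢q = φ-≢ (λ ()) ; p≢r = φ-≢ (λ ()) ; q≢r = φ-≢ (λ ()) }

  7-neighbours : ThreeNeighbours (g v7) (g v6) (g v8) (g v10)
  7-neighbours = record
    { within = λ e → case closed-neighbour (λ ()) e of λ where
        (_ , inj₁ e7-8 , refl) → inj₂ (inj₁ refl)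
        (_ , inj₁ e7-10 , refl) → inj₂ (inj₂ refl)
        (_ , inj₂ e6-7 , refl) → inj₁ refl
    ; p≢q = φ-≢ (λ ()) ; p≢r = φ-≢ (λ ()) ; q≢r = φ-≢ (λ ()) }

  3-neighbours : ThreeNeighbours (g v3) (g v4) (g v2) (g v1)
  3-neighbours = record
    { within = λ e → case closed-neighbour (λ ()) e of λ where
        (_ , inj₁ e3-4 , refl) → inj₁ refl
        (_ , inj₂ e1-3 , refl) → inj₂ (inj₂ refl)
        (_ , inj₂ e2-3 , refl) → inj₂ (inj₁ refl)
    ; p≢q = φ-≢ (λ ()) ; p≢r = φ-≢ (λ ()) ; q≢r = φ-≢ (λ ()) }

  8-neighbours : ThreeNeighbours (g v8) (g v7) (g v1) (g v9)
  8-neighbours = record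
    { within = λ e → case closed-neighbour (λ ()) e of λ where
        (_ , inj₁ e8-9 , refl) → inj₂ (inj₂ refl)
        (_ , inj₂ e1-8 , refl) → inj₂ (inj₁ refl)
        (_ , inj₂ e7-8 , refl) → inj₁ refl
    ; p≢q = φ-≢ (λ ()) ; p≢r = φ-≢ (λ ()) ; q≢r = φ-≢ (λ ()) }

  5-neighbours : ThreeNeighbours (g v5) (g v4) (g v2) (r 1)
  5-neighbours = record
    { within = λ e → case closed-neighbour (λ ()) e of λ where
        (_ , inj₁ (e5-b i p) , refl) → inj₂ (inj₂ (cong φ (sym (row-bot i p))))
        (_ , inj₂ e2-5 , refl) → inj₂ (inj₁ refl)
        (_ , inj₂ e4-5 , refl) → inj₁ refl
    ; p≢q = φ-≢ (λ ()) ; p≢r = g≢r 1 (λ ()) (λ ()) ; q≢r = g≢r 1 (λ ()) (λ ()) }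

  10-neighbours : ThreeNeighbours (g v10) (g v7) (g v9) (r (suc L))
  10-neighbours = record
    { within = λ e → case closed-neighbour (λ ()) e of λ where
        (_ , inj₁ (e10-b i p) , refl) →
          inj₂ (inj₂ (cong φ (sym (row-bot i (suc-injective (trans p N≡1+L))))))
        (_ , inj₂ e7-10 , refl) → inj₁ refl
        (_ , inj₂ e9-10 , refl) → inj₂ (inj₁ refl)
    ; p≢q = φ-≢ (λ ()) ; p≢r = g≢r (suc L) (λ ()) (λ ()) ; q≢r = g≢r (suc L) (λ ()) (λ ()) }

  1-neighbours : ThreeNeighbours (g v1) (g v3) (g v8) (portExt port₁)
  1-neighbours = record
    { within = λ e → case attachment-neighbour at1 e of λ where
        (inj₁ (_ , inj₁ e1-3 , refl)) → inj₁ refl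
        (inj₁ (_ , inj₁ e1-8 , refl)) → inj₂ (inj₁ refl)
        (inj₁ (_ , inj₁ (e1-b i j p) , refl)) → ⊥-elim (not-1~odd-bot i (j , p) e)
        (inj₂ refl) → inj₂ (inj₂ refl)
    ; p≢q = φ-≢ (λ ()) ; p≢r = g≢ext port₁ ; q≢r = g≢ext port₁ }

  2-neighbours : ThreeNeighbours (g v2) (g v3) (g v5) (portExt port₂)
  2-neighbours = record
    { within = λ e → case attachment-neighbour at2 e of λ where
        (inj₁ (_ , inj₁ e2-3 , refl)) → inj₁ refl
        (inj₁ (_ , inj₁ e2-5 , refl)) → inj₂ (inj₁ refl)
        (inj₂ refl) → inj₂ (inj₂ refl)
    ; p≢q = φ-≢ (λ ()) ; p≢r = g≢ext port₂ ; q≢r = g≢ext port₂ }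

  9-neighbours : ThreeNeighbours (g v9) (g v8) (g v10) (portExt port₉)
  9-neighbours = record
    { within = λ e → case attachment-neighbour at9 e of λ where
        (inj₁ (_ , inj₁ e9-10 , refl)) → inj₂ (inj₁ refl)
        (inj₁ (_ , inj₂ e8-9 , refl)) → inj₁ refl
        (inj₂ refl) → inj₂ (inj₂ refl)
    ; p≢q = φ-≢ (λ ()) ; p≢r = g≢ext port₉ ; q≢r = g≢ext port₉ }

  crossing-cases : ∀ u {y} → ¬ H y → φ u ~ y →
    (∃ λ p → u ≡ inn (portVertex p) × y ≡ portExt p) ⊎ (∃ λ k → k ≤ L × φ u ≡ r (suc k))
  crossing-cases (inn v1) ¬Hy e = inj₁ (port₁ , refl , ext-unique _ at1 ¬Hy e)
  crossing-cases (inn v2) ¬Hy e = inj₁ (port₂ , refl , ext-unique _ at2 ¬Hy e)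
  crossing-cases (inn v9) ¬Hy e = inj₁ (port₉ , refl , ext-unique _ at9 ¬Hy e)
  crossing-cases (bot i)  _   _ = inj₂ (toℕ i , index≤L i , cong φ (sym (row-bot i refl)))
  crossing-cases (inn v3) ¬Hy e = ⊥-elim (no-exit (λ ()) ¬Hy e)
  crossing-cases (inn v4) ¬Hy e = ⊥-elim (no-exit (λ ()) ¬Hy e)
  crossing-cases (inn v5) ¬Hy e = ⊥-elim (no-exit (λ ()) ¬Hy e)
  crossing-cases (inn v6) ¬Hy e = ⊥-elim (no-exit (λ ()) ¬Hy e)
  crossing-cases (inn v7) ¬Hy e = ⊥-elim (no-exit (λ ()) ¬Hy e)
  crossing-cases (inn v8) ¬Hy e = ⊥-elim (no-exit (λ ()) ¬Hy e)
  crossing-cases (inn v10) ¬Hy e = ⊥-elim (no-exit (λ ()) ¬Hy e)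

  exit-crossing : ∀ p → Exit p → Crossing H (g (portVertex p)) (portExt p)
  exit-crossing p e = (inn _ , refl) , ext-outside _ (port-attachment p) , e

  finish-at-two-ports : ∀ p q → portVertex p ≢ portVertex q → Exit p → Exit q →
    (∀ p′ → Exit p′ → p′ ≡ p ⊎ p′ ≡ q) → g v5 ~ r 1 → g v10 ~ r (suc L) → ExactlyTwoCrossings H
  finish-at-two-ports p q p≢q exit-p exit-q only 5~b₁ 10~bₗ =
    exactly-two-crossings H (exit-crossing p exit-p) (exit-crossing q exit-q) (φ-≢ (p≢q ∘ inn-injective)) crossing
    where
    crossing : ∀ {x y} → Crossing H x y → _
    crossing ((u , refl) , ¬Hy , e) with crossing-cases u ¬Hy e
    ... | inj₂ (k , k≤L , x≡) = ⊥-elim (no-row-exit 5~b₁ 10~bₗ k≤L ¬Hy (subst (_~ _) x≡ e))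
    ... | inj₁ (p′ , refl , refl) with only p′ e
    ...   | inj₁ refl = inj₁ refl
    ...   | inj₂ refl = inj₂ refl

  finish-at-port-and-row : ∀ p → Exit p → (∀ p′ → Exit p′ → p′ ≡ p) → ∀ {k y} → UniqueRowExit k y →
    ExactlyTwoCrossings H
  finish-at-port-and-row p exit-p only (k≤L , ¬Hy , e , row-only) =
    exactly-two-crossings H (exit-crossing p exit-p) ((row _ , refl) , ¬Hy , e) (g≢r _ (port≢5 p) (port≢10 p)) crossing
    where
    crossing : ∀ {x y} → Crossing H x y → _
    crossing ((u , refl) , ¬Hy′ , e′) with crossing-cases u ¬Hy′ e′
    ... | inj₁ (p′ , refl , refl) with only p′ e′
    ...   | refl = inj₁ refl
    crossing ((u , refl) , ¬Hy′ , e′) | inj₂ (k′ , k′≤L , x≡) with row-only k′≤L ¬Hy′ (subst (_~ _) x≡ e′)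
    ...   | row≡ = inj₂ (trans (cong (_, _) x≡) row≡)

  Among : (Inner → Set) → Fin n → Set
  Among T y = ∃ λ v → T v × y ≡ g v

  no-cycle-inside : (S : Fin n → Set) → (∀ {x y} → S x → x ~ y → S y) → (∀ {x} → S x → H x) →
    ∀ {x} → ¬ S x
  no-cycle-inside S closed inside Sx = proj₂ outside (inside (closed⇒universal S closed Sx (proj₁ outside)))

  no-inner-cycle : (T : Inner → Set) → (∀ {v y} → T v → g v ~ y → Among T y) → ∀ {v} → ¬ T v
  no-inner-cycle T closed Tv = no-cycle-inside (Among T) closed′ (λ { (v , _ , refl) → inn v , refl }) (_ , Tv , refl)
    where
    closed′ : ∀ {x y} → Among T x → x ~ y → Among T y
    closed′ (_ , Tv , refl) = closed Tv

  no-cycle-through-row : g v5 ~ r 1 → g v10 ~ r (suc L) → (T : Inner → Set) → T v5 → T v10 →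
    (∀ {v y} → T v → g v ~ y → Among T y ⊎ OnRow y) → ⊥
  no-cycle-through-row 5~b₁ 10~bₗ T T5 T10 closed =
    no-cycle-inside S closed′ inside (inj₁ (v5 , T5 , refl))
    where
    S : Fin n → Set
    S y = Among T y ⊎ OnRow y

    inside : ∀ {x} → S x → H x
    inside (inj₁ (v , _ , refl)) = inn v , refl
    inside (inj₂ on-row) = on-row-inside on-row

    closed′ : ∀ {x y} → S x → x ~ y → S y
    closed′ (inj₁ (_ , Tv , refl)) e = closed Tv e
    closed′ (inj₂ (zero , refl)) e = closed T5 e
    closed′ (inj₂ (suc k , refl)) e with ≤-<-connex k L
    ... | inj₁ k≤L = inj₂ (row-closed k≤L (edge-into 5~b₁ k≤L) (edge-out-of 10~bₗ k≤L) e)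
    ... | inj₂ L<k = closed T10 (subst (_~ _) (cong φ (row-beyond L<k)) e)

  neighbours-among : ∀ {T : Inner → Set} {x w₁ w₂} → T w₁ → T w₂ → x ~ g w₁ → x ~ g w₂ → w₁ ≢ w₂ →
    ∀ {y} → x ~ y → Among T y
  neighbours-among t₁ t₂ e₁ e₂ w₁≢w₂ =
    neighbours-within (Among _) (_ , t₁ , refl) (_ , t₂ , refl) e₁ e₂ (φ-≢ (w₁≢w₂ ∘ inn-injective))

  neighbours-among-or-row : ∀ {T : Inner → Set} {x w} k → T w → x ~ g w → x ~ r k → w ≢ v5 → w ≢ v10 →
    ∀ {y} → x ~ y → Among T y ⊎ OnRow y
  neighbours-among-or-row k t e₁ e₂ w≢5 w≢10 e with at-most-two e₁ e₂ (g≢r k w≢5 w≢10) e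
  ... | inj₁ refl = inj₁ (_ , t , refl)
  ... | inj₂ refl = inj₂ (k , refl)

  6~4 : g v6 ~ g v4
  6~4 = proj₁ 6-neighbours

  6~7 : g v6 ~ g v7
  6~7 = proj₂ 6-neighbours

  7-cases : (g v7 ~ g v8 × ¬ g v7 ~ g v10) ⊎ (g v7 ~ g v10 × ¬ g v7 ~ g v8)
  7-cases = one-other-if-first 7-neighbours (~-sym 6~7)

  module Case-4~3 (4~3 : g v4 ~ g v3) (4≁5 : ¬ g v4 ~ g v5) where

    5~2 : g v5 ~ g v2
    5~2 = proj₁ (others-if-not-first 5-neighbours (4≁5 ∘ ~-sym))

    5~b₁ : g v5 ~ r 1
    5~b₁ = proj₂ (others-if-not-first 5-neighbours (4≁5 ∘ ~-sym))

    module Case-3~2 (3~2 : g v3 ~ g v2) (3≁1 : ¬ g v3 ~ g v1) where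

      2≁W₂ : ¬ Exit port₂
      2≁W₂ = not-third 2-neighbours (~-sym 3~2) (~-sym 5~2)

      1~8 : g v1 ~ g v8
      1~8 = proj₁ (others-if-not-first 1-neighbours (3≁1 ∘ ~-sym))

      1~W₁ : Exit port₁
      1~W₁ = proj₂ (others-if-not-first 1-neighbours (3≁1 ∘ ~-sym))

      no-cycle-5-2-3-4-6-7-10-row : g v7 ~ g v10 → g v10 ~ r (suc L) → ⊥
      no-cycle-5-2-3-4-6-7-10-row 7~10 10~bₗ = no-cycle-through-row 5~b₁ 10~bₗ T tt tt closed
        where
        T : Inner → Set
        T = λ { v1 → ⊥ ; v8 → ⊥ ; v9 → ⊥ ; _ → ⊤ }
        closed : ∀ {v y} → T v → g v ~ y → Among T y ⊎ OnRow y
        closed {v2}  _ e = inj₁ (neighbours-among tt tt (~-sym 3~2) (~-sym 5~2) (λ ()) e)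
        closed {v3}  _ e = inj₁ (neighbours-among tt tt (~-sym 4~3) 3~2 (λ ()) e)
        closed {v4}  _ e = inj₁ (neighbours-among tt tt (~-sym 6~4) 4~3 (λ ()) e)
        closed {v5}  _ e = neighbours-among-or-row 1 tt 5~2 5~b₁ (λ ()) (λ ()) e
        closed {v6}  _ e = inj₁ (neighbours-among tt tt 6~4 6~7 (λ ()) e)
        closed {v7}  _ e = inj₁ (neighbours-among tt tt (~-sym 6~7) 7~10 (λ ()) e)
        closed {v10} _ e = neighbours-among-or-row (suc L) tt (~-sym 7~10) 10~bₗ (λ ()) (λ ()) e

      result : ExactlyTwoCrossings H
      result with 7-cases
      ... | inj₁ (7~8 , 7≁10) =
        finish-at-two-ports port₁ port₉ (λ ()) 1~W₁ 9~W₉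
          (λ { port₁ _ → inj₁ refl ; port₂ e → ⊥-elim (2≁W₂ e) ; port₉ _ → inj₂ refl })
          5~b₁ (proj₂ (others-if-not-first 10-neighbours (7≁10 ∘ ~-sym)))
        where
        8≁9 = not-third 8-neighbours (~-sym 7~8) (~-sym 1~8)
        9~W₉ = proj₂ (others-if-not-first 9-neighbours (8≁9 ∘ ~-sym))
      ... | inj₂ (7~10 , 7≁8) with one-other-if-first 10-neighbours (~-sym 7~10)
      ...   | inj₂ (10~bₗ , _) = ⊥-elim (no-cycle-5-2-3-4-6-7-10-row 7~10 10~bₗ)
      ...   | inj₁ (10~9 , 10≁bₗ) =
        finish-at-port-and-row port₁ 1~W₁
          (λ { port₁ _ → refl ; port₂ e → ⊥-elim (2≁W₂ e) ; port₉ e → ⊥-elim (9≁W₉ e) })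
          (proj₂ (row-end-exit 5~b₁ 10≁bₗ))
        where
        8~9 = proj₂ (others-if-not-first 8-neighbours (7≁8 ∘ ~-sym))
        9≁W₉ = not-third 9-neighbours (~-sym 8~9) (~-sym 10~9)

    module Case-3~1 (3~1 : g v3 ~ g v1) (3≁2 : ¬ g v3 ~ g v2) where

      2~W₂ : Exit port₂
      2~W₂ = proj₂ (others-if-not-first 2-neighbours (3≁2 ∘ ~-sym))

      no-cycle-1-3-4-6-7-8 : g v7 ~ g v8 → g v8 ~ g v1 → ⊥
      no-cycle-1-3-4-6-7-8 7~8 8~1 = no-inner-cycle T closed {v1} tt
        where
        T : Inner → Set
        T = λ { v1 → ⊤ ; v3 → ⊤ ; v4 → ⊤ ; v6 → ⊤ ; v7 → ⊤ ; v8 → ⊤ ; _ → ⊥ }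
        closed : ∀ {v y} → T v → g v ~ y → Among T y
        closed {v1} _ = neighbours-among tt tt (~-sym 3~1) (~-sym 8~1) (λ ())
        closed {v3} _ = neighbours-among tt tt (~-sym 4~3) 3~1 (λ ())
        closed {v4} _ = neighbours-among tt tt (~-sym 6~4) 4~3 (λ ())
        closed {v6} _ = neighbours-among tt tt 6~4 6~7 (λ ())
        closed {v7} _ = neighbours-among tt tt (~-sym 6~7) 7~8 (λ ())
        closed {v8} _ = neighbours-among tt tt (~-sym 7~8) 8~1 (λ ())

      no-cycle-1-3-4-6-7-10-9-8 : g v7 ~ g v10 → g v10 ~ g v9 → g v8 ~ g v1 → g v8 ~ g v9 → ⊥
      no-cycle-1-3-4-6-7-10-9-8 7~10 10~9 8~1 8~9 = no-inner-cycle T closed {v1} tt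
        where
        T : Inner → Set
        T = λ { v2 → ⊥ ; v5 → ⊥ ; _ → ⊤ }
        closed : ∀ {v y} → T v → g v ~ y → Among T y
        closed {v1}  _ = neighbours-among tt tt (~-sym 3~1) (~-sym 8~1) (λ ())
        closed {v3}  _ = neighbours-among tt tt (~-sym 4~3) 3~1 (λ ())
        closed {v4}  _ = neighbours-among tt tt (~-sym 6~4) 4~3 (λ ())
        closed {v6}  _ = neighbours-among tt tt 6~4 6~7 (λ ())
        closed {v7}  _ = neighbours-among tt tt (~-sym 6~7) 7~10 (λ ())
        closed {v8}  _ = neighbours-among tt tt 8~1 8~9 (λ ())
        closed {v9}  _ = neighbours-among tt tt (~-sym 8~9) (~-sym 10~9) (λ ())
        closed {v10} _ = neighbours-among tt tt (~-sym 7~10) 10~9 (λ ())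

      result : ExactlyTwoCrossings H
      result with 7-cases
      ... | inj₁ (7~8 , 7≁10) with one-other-if-first 8-neighbours (~-sym 7~8)
      ...   | inj₁ (8~1 , _) = ⊥-elim (no-cycle-1-3-4-6-7-8 7~8 8~1)
      ...   | inj₂ (8~9 , 8≁1) =
        finish-at-two-ports port₂ port₁ (λ ()) 2~W₂ 1~W₁
          (λ { port₁ _ → inj₂ refl ; port₂ _ → inj₁ refl ; port₉ e → ⊥-elim (9≁W₉ e) })
          5~b₁ 10~bₗ
        where
        10~9 = proj₁ (others-if-not-first 10-neighbours (7≁10 ∘ ~-sym))
        10~bₗ = proj₂ (others-if-not-first 10-neighbours (7≁10 ∘ ~-sym))
        1~W₁ = proj₂ (others-if-not-first (swap-first 1-neighbours) (8≁1 ∘ ~-sym))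
        9≁W₉ = not-third 9-neighbours (~-sym 8~9) (~-sym 10~9)
      result | inj₂ (7~10 , 7≁8) with others-if-not-first 8-neighbours (7≁8 ∘ ~-sym)
      ...   | 8~1 , 8~9 with one-other-if-first 10-neighbours (~-sym 7~10)
      ...     | inj₁ (10~9 , _) = ⊥-elim (no-cycle-1-3-4-6-7-10-9-8 7~10 10~9 8~1 8~9)
      ...     | inj₂ (10~bₗ , 10≁9) =
        finish-at-two-ports port₂ port₉ (λ ()) 2~W₂ 9~W₉
          (λ { port₁ e → ⊥-elim (1≁W₁ e) ; port₂ _ → inj₁ refl ; port₉ _ → inj₂ refl })
          5~b₁ 10~bₗ
        where
        1≁W₁ = not-third 1-neighbours (~-sym 3~1) (~-sym 8~1)
        9~W₉ = proj₂ (others-if-not-first (swap-first 9-neighbours) (10≁9 ∘ ~-sym))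

    result : ExactlyTwoCrossings H
    result with one-other-if-first 3-neighbours (~-sym 4~3)
    ... | inj₁ (3~2 , 3≁1) = Case-3~2.result 3~2 3≁1
    ... | inj₂ (3~1 , 3≁2) = Case-3~1.result 3~1 3≁2

  module Case-4~5 (4~5 : g v4 ~ g v5) (4≁3 : ¬ g v4 ~ g v3) where

    3~2 : g v3 ~ g v2
    3~2 = proj₁ (others-if-not-first 3-neighbours (4≁3 ∘ ~-sym))

    3~1 : g v3 ~ g v1
    3~1 = proj₂ (others-if-not-first 3-neighbours (4≁3 ∘ ~-sym))

    module Case-5~2 (5~2 : g v5 ~ g v2) (5≁b₁ : ¬ g v5 ~ r 1) where

      2≁W₂ : ¬ Exit port₂
      2≁W₂ = not-third 2-neighbours (~-sym 3~2) (~-sym 5~2)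

      no-cycle-1-3-2-5-4-6-7-8 : g v7 ~ g v8 → g v8 ~ g v1 → ⊥
      no-cycle-1-3-2-5-4-6-7-8 7~8 8~1 = no-inner-cycle T closed {v1} tt
        where
        T : Inner → Set
        T = λ { v9 → ⊥ ; v10 → ⊥ ; _ → ⊤ }
        closed : ∀ {v y} → T v → g v ~ y → Among T y
        closed {v1} _ = neighbours-among tt tt (~-sym 3~1) (~-sym 8~1) (λ ())
        closed {v2} _ = neighbours-among tt tt (~-sym 3~2) (~-sym 5~2) (λ ())
        closed {v3} _ = neighbours-among tt tt 3~1 3~2 (λ ())
        closed {v4} _ = neighbours-among tt tt 4~5 (~-sym 6~4) (λ ())
        closed {v5} _ = neighbours-among tt tt (~-sym 4~5) 5~2 (λ ())
        closed {v6} _ = neighbours-among tt tt 6~4 6~7 (λ ())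
        closed {v7} _ = neighbours-among tt tt (~-sym 6~7) 7~8 (λ ())
        closed {v8} _ = neighbours-among tt tt (~-sym 7~8) 8~1 (λ ())

      no-cycle-1-3-2-5-4-6-7-10-9-8 : g v7 ~ g v10 → g v10 ~ g v9 → g v8 ~ g v1 → g v8 ~ g v9 → ⊥
      no-cycle-1-3-2-5-4-6-7-10-9-8 7~10 10~9 8~1 8~9 = no-inner-cycle T closed {v1} tt
        where
        T : Inner → Set
        T = λ _ → ⊤
        closed : ∀ {v y} → T v → g v ~ y → Among T y
        closed {v1}  _ = neighbours-among tt tt (~-sym 3~1) (~-sym 8~1) (λ ())
        closed {v2}  _ = neighbours-among tt tt (~-sym 3~2) (~-sym 5~2) (λ ())
        closed {v3}  _ = neighbours-among tt tt 3~1 3~2 (λ ())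
        closed {v4}  _ = neighbours-among tt tt 4~5 (~-sym 6~4) (λ ())
        closed {v5}  _ = neighbours-among tt tt (~-sym 4~5) 5~2 (λ ())
        closed {v6}  _ = neighbours-among tt tt 6~4 6~7 (λ ())
        closed {v7}  _ = neighbours-among tt tt (~-sym 6~7) 7~10 (λ ())
        closed {v8}  _ = neighbours-among tt tt 8~1 8~9 (λ ())
        closed {v9}  _ = neighbours-among tt tt (~-sym 8~9) (~-sym 10~9) (λ ())
        closed {v10} _ = neighbours-among tt tt (~-sym 7~10) 10~9 (λ ())

      result : ExactlyTwoCrossings H
      result with 7-cases
      ... | inj₁ (7~8 , 7≁10) with one-other-if-first 8-neighbours (~-sym 7~8)
      ...   | inj₁ (8~1 , _) = ⊥-elim (no-cycle-1-3-2-5-4-6-7-8 7~8 8~1)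
      ...   | inj₂ (8~9 , 8≁1) =
        finish-at-port-and-row port₁ 1~W₁
          (λ { port₁ _ → refl ; port₂ e → ⊥-elim (2≁W₂ e) ; port₉ e → ⊥-elim (9≁W₉ e) })
          (proj₂ (row-start-exit 5≁b₁ 10~bₗ))
        where
        10~9 = proj₁ (others-if-not-first 10-neighbours (7≁10 ∘ ~-sym))
        10~bₗ = proj₂ (others-if-not-first 10-neighbours (7≁10 ∘ ~-sym))
        1~W₁ = proj₂ (others-if-not-first (swap-first 1-neighbours) (8≁1 ∘ ~-sym))
        9≁W₉ = not-third 9-neighbours (~-sym 8~9) (~-sym 10~9)
      result | inj₂ (7~10 , 7≁8) with others-if-not-first 8-neighbours (7≁8 ∘ ~-sym)
      ...   | 8~1 , 8~9 with one-other-if-first 10-neighbours (~-sym 7~10)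
      ...     | inj₁ (10~9 , _) = ⊥-elim (no-cycle-1-3-2-5-4-6-7-10-9-8 7~10 10~9 8~1 8~9)
      ...     | inj₂ (10~bₗ , 10≁9) =
        finish-at-port-and-row port₉ 9~W₉
          (λ { port₁ e → ⊥-elim (1≁W₁ e) ; port₂ e → ⊥-elim (2≁W₂ e) ; port₉ _ → refl })
          (proj₂ (row-start-exit 5≁b₁ 10~bₗ))
        where
        1≁W₁ = not-third 1-neighbours (~-sym 3~1) (~-sym 8~1)
        9~W₉ = proj₂ (others-if-not-first (swap-first 9-neighbours) (10≁9 ∘ ~-sym))

    module Case-5~b₁ (5~b₁ : g v5 ~ r 1) (5≁2 : ¬ g v5 ~ g v2) where

      2~W₂ : Exit port₂
      2~W₂ = proj₂ (others-if-not-first (swap-first 2-neighbours) (5≁2 ∘ ~-sym))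

      no-cycle-5-4-6-7-8-9-10-row : g v7 ~ g v8 → g v8 ~ g v9 → g v10 ~ g v9 → g v10 ~ r (suc L) → ⊥
      no-cycle-5-4-6-7-8-9-10-row 7~8 8~9 10~9 10~bₗ = no-cycle-through-row 5~b₁ 10~bₗ T tt tt closed
        where
        T : Inner → Set
        T = λ { v1 → ⊥ ; v2 → ⊥ ; v3 → ⊥ ; _ → ⊤ }
        closed : ∀ {v y} → T v → g v ~ y → Among T y ⊎ OnRow y
        closed {v4}  _ e = inj₁ (neighbours-among tt tt 4~5 (~-sym 6~4) (λ ()) e)
        closed {v5}  _ e = neighbours-among-or-row 1 tt (~-sym 4~5) 5~b₁ (λ ()) (λ ()) e
        closed {v6}  _ e = inj₁ (neighbours-among tt tt 6~4 6~7 (λ ()) e)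
        closed {v7}  _ e = inj₁ (neighbours-among tt tt (~-sym 6~7) 7~8 (λ ()) e)
        closed {v8}  _ e = inj₁ (neighbours-among tt tt (~-sym 7~8) 8~9 (λ ()) e)
        closed {v9}  _ e = inj₁ (neighbours-among tt tt (~-sym 8~9) (~-sym 10~9) (λ ()) e)
        closed {v10} _ e = neighbours-among-or-row (suc L) tt 10~9 10~bₗ (λ ()) (λ ()) e

      no-cycle-5-4-6-7-10-row : g v7 ~ g v10 → g v10 ~ r (suc L) → ⊥
      no-cycle-5-4-6-7-10-row 7~10 10~bₗ = no-cycle-through-row 5~b₁ 10~bₗ T tt tt closed
        where
        T : Inner → Set
        T = λ { v4 → ⊤ ; v5 → ⊤ ; v6 → ⊤ ; v7 → ⊤ ; v10 → ⊤ ; _ → ⊥ }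
        closed : ∀ {v y} → T v → g v ~ y → Among T y ⊎ OnRow y
        closed {v4}  _ e = inj₁ (neighbours-among tt tt 4~5 (~-sym 6~4) (λ ()) e)
        closed {v5}  _ e = neighbours-among-or-row 1 tt (~-sym 4~5) 5~b₁ (λ ()) (λ ()) e
        closed {v6}  _ e = inj₁ (neighbours-among tt tt 6~4 6~7 (λ ()) e)
        closed {v7}  _ e = inj₁ (neighbours-among tt tt (~-sym 6~7) 7~10 (λ ()) e)
        closed {v10} _ e = neighbours-among-or-row (suc L) tt (~-sym 7~10) 10~bₗ (λ ()) (λ ()) e

      result : ExactlyTwoCrossings H
      result with 7-cases
      ... | inj₁ (7~8 , 7≁10) with others-if-not-first 10-neighbours (7≁10 ∘ ~-sym)
      ...   | 10~9 , 10~bₗ with one-other-if-first 8-neighbours (~-sym 7~8)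
      ...     | inj₂ (8~9 , _) = ⊥-elim (no-cycle-5-4-6-7-8-9-10-row 7~8 8~9 10~9 10~bₗ)
      ...     | inj₁ (8~1 , 8≁9) =
        finish-at-two-ports port₂ port₉ (λ ()) 2~W₂ 9~W₉
          (λ { port₁ e → ⊥-elim (1≁W₁ e) ; port₂ _ → inj₁ refl ; port₉ _ → inj₂ refl })
          5~b₁ 10~bₗ
        where
        1≁W₁ = not-third 1-neighbours (~-sym 3~1) (~-sym 8~1)
        9~W₉ = proj₂ (others-if-not-first 9-neighbours (8≁9 ∘ ~-sym))
      result | inj₂ (7~10 , 7≁8) with one-other-if-first 10-neighbours (~-sym 7~10)
      ...   | inj₂ (10~bₗ , _) = ⊥-elim (no-cycle-5-4-6-7-10-row 7~10 10~bₗ)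
      ...   | inj₁ (10~9 , 10≁bₗ) =
        finish-at-port-and-row port₂ 2~W₂
          (λ { port₁ e → ⊥-elim (1≁W₁ e) ; port₂ _ → refl ; port₉ e → ⊥-elim (9≁W₉ e) })
          (proj₂ (row-end-exit 5~b₁ 10≁bₗ))
        where
        8~1 = proj₁ (others-if-not-first 8-neighbours (7≁8 ∘ ~-sym))
        8~9 = proj₂ (others-if-not-first 8-neighbours (7≁8 ∘ ~-sym))
        1≁W₁ = not-third 1-neighbours (~-sym 3~1) (~-sym 8~1)
        9≁W₉ = not-third 9-neighbours (~-sym 8~9) (~-sym 10~9)

    result : ExactlyTwoCrossings H
    result with one-other-if-first 5-neighbours (~-sym 4~5)
    ... | inj₁ (5~2 , 5≁b₁) = Case-5~2.result 5~2 5≁b₁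
    ... | inj₂ (5~b₁ , 5≁2) = Case-5~b₁.result 5~b₁ 5≁2

  result : ExactlyTwoCrossings H
  result with one-other-if-first 4-neighbours (~-sym 6~4)
  ... | inj₁ (4~3 , 4≁5) = Case-4~3.result 4~3 4≁5
  ... | inj₂ (4~5 , 4≁3) = Case-4~5.result 4~5 4≁3

lemma4p2 : (s : ℕ) → 4 ≤ s →
    (n : ℕ) (G : SimpleGraph n) (φ : GateV s → Fin n) →
    IsInducedCopy G s φ →
    (∃ λ v → ¬ InH G s φ v) →
    ExternalEdgesOK G s φ →
    (C : HamCycle G) →
    (∀ (i j : Fin (bottomSize s)) → toℕ j ≡ suc (toℕ i) → CycleEdge C (φ (bot i)) (φ (bot j))) →
    ∃ λ i → ∃ λ j → i ≢ j × CrossesAt C (InH G s φ) i × CrossesAt C (InH G s φ) j ×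
      (∀ k → CrossesAt C (InH G s φ) k → k ≡ i ⊎ k ≡ j)
lemma4p2 s 4≤s n G φ induced outside external C bottom-path =
  GateInCycle.result s 4≤s G φ induced outside external C bottom-path
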